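{- Let $R=\mathrm{GR}(4,m)$ with residue field $K$ and reduction map $\mu:R\to K$. Let $\Sigma=\prod_{i=1}^r(1-Y_iz)^{a_i}\in R[z]$ with $a_i\in\{1,2\}$, $Y_i\in R$ such that $\mu Y_1,\dots,\mu Y_r\in K^\times$ are pairwise distinct, indexed so that $a_i=2$ exactly for $i\le s$, and let $\tau=\prod_{i=1}^s(1-Y_iz)^2$. Then $(\Sigma,\Sigma_{\mathrm{even}})=(\tau,\tau_{\mathrm{even}})$ as ideals of $R[z]$.
   Context: $\mu$ is the canonical map $a\mapsto a+2R$. For $P=\sum_kP_kz^k\in R[z]$, $P_{\mathrm{even}}=\sum_jP_{2j}z^{2j}$ and $P_{\mathrm{odd}}=\sum_jP_{2j+1}z^{2j+1}$. $(f,g)=R[z]f+R[z]g$. -}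

module Defs where

open import Level using (Level; _⊔_)
open import Algebra.Bundles using (CommutativeRing)
open import Data.Nat as ℕ using (ℕ; zero; suc; _^_)
open import Data.Fin as Fin using (Fin; toℕ)
open import Data.List using (List; []; _∷_; map)
open import Data.Product using (Σ; ∃; _×_; _,_)
open import Data.Sum using (_⊎_)
open import Data.Unit.Polymorphic using (⊤)
open import Relation.Nullary using (¬_)
open import Function.Bundles using (_⇔_)
open import Relation.Binary.PropositionalEquality using (_≡_)

module RingDefs {c ℓ : Level} (R : CommutativeRing c ℓ) where
  open CommutativeRing R

  two : Carrier
  two = 1# + 1#

  In2R : Carrier → Set (c ⊔ ℓ)
  In2R a = ∃ λ b → a ≈ two * b

  -- μ a = μ b in K = R/2R
  _≈μ_ : Carrier → Carrier → Set (c ⊔ ℓ)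
  a ≈μ b = In2R (a - b)

  μUnit : Carrier → Set (c ⊔ ℓ)
  μUnit a = ¬ In2R a

  IsUnit : Carrier → Set (c ⊔ ℓ)
  IsUnit a = ∃ λ b → a * b ≈ 1#

  -- Galois ring GR(4,m): a finite commutative local ring of characteristic 4
  -- with 4^m elements whose maximal ideal is 2R (Wan's characterization).
  record IsGaloisRing4 (m : ℕ) : Set (c ⊔ ℓ) where
    field
      m≥1        : 1 ℕ.≤ m
      char4      : two + two ≈ 0#
      two≉0      : ¬ (two ≈ 0#)
      local2R    : ∀ a → IsUnit a ⊎ In2R a
      enum       : Fin (4 ^ m) → Carrier
      enum-surj  : ∀ a → ∃ λ i → enum i ≈ a
      enum-inj   : ∀ i j → enum i ≈ enum j → i ≡ j

  -- polynomials in R[z] as coefficient lists (lowest degree first)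
  Poly : Set c
  Poly = List Carrier

  data _≈ₚ_ : Poly → Poly → Set (c ⊔ ℓ) where
    []≈[] : [] ≈ₚ []
    []≈∷  : ∀ {b q} → b ≈ 0# → [] ≈ₚ q → [] ≈ₚ (b ∷ q)
    ∷≈[]  : ∀ {a p} → a ≈ 0# → p ≈ₚ [] → (a ∷ p) ≈ₚ []
    ∷≈∷   : ∀ {a b p q} → a ≈ b → p ≈ₚ q → (a ∷ p) ≈ₚ (b ∷ q)

  _+ₚ_ : Poly → Poly → Poly
  [] +ₚ q = q
  (a ∷ p) +ₚ [] = a ∷ p
  (a ∷ p) +ₚ (b ∷ q) = (a + b) ∷ (p +ₚ q)

  _*ₚ_ : Poly → Poly → Poly
  [] *ₚ q = []
  (a ∷ p) *ₚ q = map (a *_) q +ₚ (0# ∷ (p *ₚ q))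

  oneₚ : Poly
  oneₚ = 1# ∷ []

  _^ₚ_ : Poly → ℕ → Poly
  p ^ₚ zero = oneₚ
  p ^ₚ suc n = p *ₚ (p ^ₚ n)

  prodₚ : (n : ℕ) → (Fin n → Poly) → Poly
  prodₚ zero f = oneₚ
  prodₚ (suc n) f = f Fin.zero *ₚ prodₚ n (λ i → f (Fin.suc i))

  lin : Carrier → Poly
  lin Y = 1# ∷ (- Y) ∷ []

  evenPart : Poly → Poly
  oddZero  : Poly → Poly
  evenPart [] = []
  evenPart (a ∷ p) = a ∷ oddZero p
  oddZero [] = []
  oddZero (a ∷ p) = 0# ∷ evenPart p

  InIdeal : Poly → Poly → Poly → Set (c ⊔ ℓ)
  InIdeal f g h = ∃ λ A → ∃ λ B → h ≈ₚ ((A *ₚ f) +ₚ (B *ₚ g))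

  SameIdeal : Poly → Poly → Poly → Poly → Set (c ⊔ ℓ)
  SameIdeal f g f' g' = ∀ h → InIdeal f g h ⇔ InIdeal f' g' h

module Submission where

-- Write a factor as L = 1 + t with t = - Y z odd, and put D = 1 - t².
-- For every P, (L P)_even = φ P := P_even + t P_odd, and φ is multiplicative
-- modulo D because t² ≡ 1.  Call P coprime to L when φ P and D generate the
-- unit ideal.  Then (L P , (L P)_even) = (P , P_even): one inclusion is the
-- formula for φ P, and P, P_even ∈ (L P , φ P) since D P = (1 - t) L P and
-- D P_even = (1 + t) φ P - t L P.  Coprimality is closed under products, and
-- 1 - Y′ z is coprime to 1 - Y z whenever Y + Y′ is a unit, which in GR(4, m)
-- follows from μ Y ≠ μ Y′.  So the simple factors of Σ are stripped one by
-- one, the double factors being carried along, and τ remains.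

open import Defs
open import Level using (Level; _⊔_)
open import Algebra.Bundles using (CommutativeRing; RawRing)
open import Data.Nat as ℕ using (ℕ; zero; suc; _∸_; _≤_; _<_; z≤n; s≤s)
open import Data.Nat.Properties using (_≟_)
open import Data.Fin as Fin using (Fin; toℕ; inject≤)
open import Data.Fin.Properties using (suc-injective)
open import Data.List using ([]; _∷_; map)
open import Data.Product using (∃; _×_; _,_)
open import Data.Product.Properties using (≡-dec)
open import Data.Sum using (_⊎_; inj₁; inj₂)
open import Data.Maybe using (Maybe; just; nothing)
open import Data.Empty using (⊥-elim)
open import Function.Base using (_∘′_)
open import Function.Bundles using (_⇔_; mk⇔; Equivalence)
open import Relation.Binary.PropositionalEquality as ≡ using (_≡_; _≢_)
open import Relation.Binary.Structures using (IsEquivalence)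
open import Relation.Binary.Bundles using (Setoid)
open import Relation.Nullary using (¬_; yes; no)
import Algebra.Solver.Ring.AlmostCommutativeRing as ACR

-- The integers, as pairs (m , n) standing for m - n with at least one
-- component zero.  They serve as the coefficients of the ring solver.
ℤ-coefficients : RawRing _ _
ℤ-coefficients = record
  { Carrier = ℕ × ℕ
  ; _≈_ = _≡_
  ; _+_ = λ { (a , b) (c , d) → normalise (a ℕ.+ c) (b ℕ.+ d) }
  ; _*_ = λ { (a , b) (c , d) → normalise (a ℕ.* c ℕ.+ b ℕ.* d) (a ℕ.* d ℕ.+ b ℕ.* c) }
  ; -_ = λ { (a , b) → (b , a) }
  ; 0# = (0 , 0)
  ; 1# = (1 , 0)
  }
  where
  normalise : ℕ → ℕ → ℕ × ℕ
  normalise m n = (m ∸ n , n ∸ m)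

-- A ring solver with integer coefficients for an arbitrary commutative
-- ring: every commutative ring receives the canonical map from ℤ.
module IntegerSolver {c ℓ : Level} (CR : CommutativeRing c ℓ) where
  open CommutativeRing CR
  open import Algebra.Properties.Ring ring using (-‿distribˡ-*; -‿distribʳ-*; -‿involutive; -‿+-comm; -0#≈0#; ⁻¹-anti-homo‿-)
  open import Algebra.Properties.Semiring.Mult.TCOptimised semiring using (1+×; ×-homo-+; ×1-homo-*)
    renaming (_×_ to _⊠_)
  import Algebra.Solver.Ring.NaturalCoefficients.Default commutativeSemiring as ℕ-Solver
  open import Relation.Binary.Reasoning.Setoid setoid

  -- the image of m - n; the clauses make ⟦ 1 , 0 ⟧ℤ = 1# and ⟦ 0 , 0 ⟧ℤ = 0#
  -- hold definitionally, so solver constants evaluate to 1# and 0#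
  ⟦_⟧ℤ : ℕ × ℕ → Carrier
  ⟦ m , zero ⟧ℤ = m ⊠ 1#
  ⟦ zero , suc n ⟧ℤ = - (suc n ⊠ 1#)
  ⟦ suc m , suc n ⟧ℤ = ⟦ m , n ⟧ℤ

  diff-suc : ∀ a b → (1# + a) - (1# + b) ≈ a - b
  diff-suc a b = begin
    (1# + a) + - (1# + b)      ≈⟨ +-congˡ (-‿+-comm 1# b) ⟨
    (1# + a) + (- 1# + - b)    ≈⟨ ℕ-Solver.solve 4 (λ o a m b → (o :+ a) :+ (m :+ b) := (a :+ b) :+ (o :+ m)) refl 1# a (- 1#) (- b) ⟩
    (a + - b) + (1# + - 1#)    ≈⟨ +-congˡ (-‿inverseʳ 1#) ⟩
    (a + - b) + 0#             ≈⟨ +-identityʳ _ ⟩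
    a - b                      ∎
    where open ℕ-Solver using (_:+_; _:=_)

  diff-+ : ∀ a b c d → (a + c) - (b + d) ≈ (a - b) + (c - d)
  diff-+ a b c d = begin
    (a + c) + - (b + d)      ≈⟨ +-congˡ (-‿+-comm b d) ⟨
    (a + c) + (- b + - d)    ≈⟨ ℕ-Solver.solve 4 (λ a c b d → (a :+ c) :+ (b :+ d) := (a :+ b) :+ (c :+ d)) refl a c (- b) (- d) ⟩
    (a - b) + (c - d)        ∎
    where open ℕ-Solver using (_:+_; _:=_)

  diff-* : ∀ a b c d → (a * c + b * d) - (a * d + b * c) ≈ (a - b) * (c - d)
  diff-* a b c d = sym (begin
    (a + - b) * (c + - d)
      ≈⟨ ℕ-Solver.solve 4 (λ a b c d → (a :+ b) :* (c :+ d) := (a :* c :+ b :* d) :+ (a :* d :+ b :* c)) refl a (- b) c (- d) ⟩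
    (a * c + - b * - d) + (a * - d + - b * c)
      ≈⟨ +-cong (+-congˡ neg-neg) (+-cong (sym (-‿distribʳ-* a d)) (sym (-‿distribˡ-* b c))) ⟩
    (a * c + b * d) + (- (a * d) + - (b * c))
      ≈⟨ +-congˡ (-‿+-comm _ _) ⟩
    (a * c + b * d) - (a * d + b * c) ∎)
    where
    open ℕ-Solver using (_:+_; _:*_; _:=_)
    neg-neg : - b * - d ≈ b * d
    neg-neg = begin
      - b * - d      ≈⟨ -‿distribˡ-* b (- d) ⟨
      - (b * - d)    ≈⟨ -‿cong (-‿distribʳ-* b d) ⟨
      - - (b * d)    ≈⟨ -‿involutive _ ⟩
      b * d          ∎

  ⟦⟧ℤ-difference : ∀ m n → ⟦ m , n ⟧ℤ ≈ m ⊠ 1# - n ⊠ 1#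
  ⟦⟧ℤ-difference m zero = sym (trans (+-congˡ -0#≈0#) (+-identityʳ _))
  ⟦⟧ℤ-difference zero (suc n) = sym (+-identityˡ _)
  ⟦⟧ℤ-difference (suc m) (suc n) = begin
    ⟦ m , n ⟧ℤ                        ≈⟨ ⟦⟧ℤ-difference m n ⟩
    m ⊠ 1# - n ⊠ 1#                  ≈⟨ diff-suc _ _ ⟨
    (1# + m ⊠ 1#) - (1# + n ⊠ 1#)    ≈⟨ +-cong (1+× m 1#) (-‿cong (1+× n 1#)) ⟨
    suc m ⊠ 1# - suc n ⊠ 1#          ∎

  ⟦⟧ℤ-normalise : ∀ m n → ⟦ m ∸ n , n ∸ m ⟧ℤ ≈ ⟦ m , n ⟧ℤ
  ⟦⟧ℤ-normalise zero zero = refl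
  ⟦⟧ℤ-normalise zero (suc n) = refl
  ⟦⟧ℤ-normalise (suc m) zero = refl
  ⟦⟧ℤ-normalise (suc m) (suc n) = ⟦⟧ℤ-normalise m n

  ⟦⟧ℤ-homomorphism : ℤ-coefficients ACR.-Raw-AlmostCommutative⟶ ACR.fromCommutativeRing CR
  ⟦⟧ℤ-homomorphism = record
    { ⟦_⟧ = ⟦_⟧ℤ
    ; +-homo = λ { (a , b) (c , d) → begin
        ⟦ a ℕ.+ c ∸ (b ℕ.+ d) , b ℕ.+ d ∸ (a ℕ.+ c) ⟧ℤ   ≈⟨ ⟦⟧ℤ-normalise (a ℕ.+ c) (b ℕ.+ d) ⟩
        ⟦ a ℕ.+ c , b ℕ.+ d ⟧ℤ                           ≈⟨ ⟦⟧ℤ-difference (a ℕ.+ c) (b ℕ.+ d) ⟩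
        (a ℕ.+ c) ⊠ 1# - (b ℕ.+ d) ⊠ 1#                 ≈⟨ +-cong (×-homo-+ 1# a c) (-‿cong (×-homo-+ 1# b d)) ⟩
        (a ⊠ 1# + c ⊠ 1#) - (b ⊠ 1# + d ⊠ 1#)           ≈⟨ diff-+ _ _ _ _ ⟩
        (a ⊠ 1# - b ⊠ 1#) + (c ⊠ 1# - d ⊠ 1#)           ≈⟨ +-cong (⟦⟧ℤ-difference a b) (⟦⟧ℤ-difference c d) ⟨
        ⟦ a , b ⟧ℤ + ⟦ c , d ⟧ℤ                           ∎ }
    ; *-homo = λ { (a , b) (c , d) →
        let p = a ℕ.* c ℕ.+ b ℕ.* d ; q = a ℕ.* d ℕ.+ b ℕ.* c in begin
        ⟦ p ∸ q , q ∸ p ⟧ℤ                               ≈⟨ ⟦⟧ℤ-normalise p q ⟩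
        ⟦ p , q ⟧ℤ                                       ≈⟨ ⟦⟧ℤ-difference p q ⟩
        p ⊠ 1# - q ⊠ 1#                                 ≈⟨ +-cong (ℕ-sum-of-products a c b d) (-‿cong (ℕ-sum-of-products a d b c)) ⟩
        (a ⊠ 1# * (c ⊠ 1#) + b ⊠ 1# * (d ⊠ 1#)) - (a ⊠ 1# * (d ⊠ 1#) + b ⊠ 1# * (c ⊠ 1#))
                                                        ≈⟨ diff-* _ _ _ _ ⟩
        (a ⊠ 1# - b ⊠ 1#) * (c ⊠ 1# - d ⊠ 1#)           ≈⟨ *-cong (⟦⟧ℤ-difference a b) (⟦⟧ℤ-difference c d) ⟨
        ⟦ a , b ⟧ℤ * ⟦ c , d ⟧ℤ                           ∎ }
    ; -‿homo = λ { (a , b) → begin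
        ⟦ b , a ⟧ℤ                   ≈⟨ ⟦⟧ℤ-difference b a ⟩
        b ⊠ 1# - a ⊠ 1#             ≈⟨ ⁻¹-anti-homo‿- _ _ ⟨
        - (a ⊠ 1# - b ⊠ 1#)         ≈⟨ -‿cong (⟦⟧ℤ-difference a b) ⟨
        - ⟦ a , b ⟧ℤ                 ∎ }
    ; 0-homo = refl
    ; 1-homo = refl
    }
    where
    ℕ-sum-of-products : ∀ a c b d → (a ℕ.* c ℕ.+ b ℕ.* d) ⊠ 1# ≈ a ⊠ 1# * (c ⊠ 1#) + b ⊠ 1# * (d ⊠ 1#)
    ℕ-sum-of-products a c b d = trans (×-homo-+ 1# (a ℕ.* c) (b ℕ.* d)) (+-cong (×1-homo-* a c) (×1-homo-* b d))

  coefficient-equality : ∀ a b → Maybe (⟦ a ⟧ℤ ≈ ⟦ b ⟧ℤ)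
  coefficient-equality a b with ≡-dec _≟_ _≟_ a b
  ... | yes ≡.refl = just refl
  ... | no _ = nothing

  open import Algebra.Solver.Ring ℤ-coefficients (ACR.fromCommutativeRing CR) ⟦⟧ℤ-homomorphism coefficient-equality public
    using (Polynomial; solve; _:=_; _:+_; _:*_; _:-_; :-_; con)

  :1 :0 : ∀ {n} → Polynomial n
  :1 = con (1 , 0)
  :0 = con (0 , 0)

module PolynomialRing {c ℓ : Level} (R : CommutativeRing c ℓ) where
  open CommutativeRing R hiding (zero)
  open RingDefs R
  open import Algebra.Properties.Ring ring using (-0#≈0#)

  coeff : Poly → ℕ → Carrier
  coeff [] n = 0#
  coeff (a ∷ p) zero = a
  coeff (a ∷ p) (suc n) = coeff p n

  -- ≈ₚ is exactly coefficientwise equality; every additive law of R[z]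
  -- is inherited from R through this characterisation
  ≈ₚ⇒coeff : ∀ {p q} → p ≈ₚ q → ∀ n → coeff p n ≈ coeff q n
  ≈ₚ⇒coeff []≈[] n = refl
  ≈ₚ⇒coeff ([]≈∷ b≈0 e) zero = sym b≈0
  ≈ₚ⇒coeff ([]≈∷ b≈0 e) (suc n) = ≈ₚ⇒coeff e n
  ≈ₚ⇒coeff (∷≈[] a≈0 e) zero = a≈0
  ≈ₚ⇒coeff (∷≈[] a≈0 e) (suc n) = ≈ₚ⇒coeff e n
  ≈ₚ⇒coeff (∷≈∷ a≈b e) zero = a≈b
  ≈ₚ⇒coeff (∷≈∷ a≈b e) (suc n) = ≈ₚ⇒coeff e n

  coeff⇒≈ₚ : ∀ {p q} → (∀ n → coeff p n ≈ coeff q n) → p ≈ₚ q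
  coeff⇒≈ₚ {[]} {[]} h = []≈[]
  coeff⇒≈ₚ {[]} {b ∷ q} h = []≈∷ (sym (h zero)) (coeff⇒≈ₚ (λ n → h (suc n)))
  coeff⇒≈ₚ {a ∷ p} {[]} h = ∷≈[] (h zero) (coeff⇒≈ₚ (λ n → h (suc n)))
  coeff⇒≈ₚ {a ∷ p} {b ∷ q} h = ∷≈∷ (h zero) (coeff⇒≈ₚ (λ n → h (suc n)))

  ≈ₚ-refl : ∀ {p} → p ≈ₚ p
  ≈ₚ-refl = coeff⇒≈ₚ (λ n → refl)

  ≈ₚ-isEquivalence : IsEquivalence _≈ₚ_
  ≈ₚ-isEquivalence = record
    { refl = ≈ₚ-refl
    ; sym = λ e → coeff⇒≈ₚ (λ n → sym (≈ₚ⇒coeff e n))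
    ; trans = λ e f → coeff⇒≈ₚ (λ n → trans (≈ₚ⇒coeff e n) (≈ₚ⇒coeff f n))
    }

  open IsEquivalence ≈ₚ-isEquivalence public
    using () renaming (sym to ≈ₚ-sym; trans to ≈ₚ-trans; reflexive to ≈ₚ-reflexive)

  ≈ₚ-setoid : Setoid c (c ⊔ ℓ)
  ≈ₚ-setoid = record { isEquivalence = ≈ₚ-isEquivalence }

  scale : Carrier → Poly → Poly
  scale a p = map (a *_) p

  negₚ : Poly → Poly
  negₚ p = map -_ p

  coeff-+ : ∀ p q n → coeff (p +ₚ q) n ≈ coeff p n + coeff q n
  coeff-+ [] q n = sym (+-identityˡ _)
  coeff-+ (a ∷ p) [] n = sym (+-identityʳ _)
  coeff-+ (a ∷ p) (b ∷ q) zero = refl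
  coeff-+ (a ∷ p) (b ∷ q) (suc n) = coeff-+ p q n

  coeff-scale : ∀ a p n → coeff (scale a p) n ≈ a * coeff p n
  coeff-scale a [] n = sym (zeroʳ a)
  coeff-scale a (b ∷ p) zero = refl
  coeff-scale a (b ∷ p) (suc n) = coeff-scale a p n

  coeff-neg : ∀ p n → coeff (negₚ p) n ≈ - coeff p n
  coeff-neg [] n = sym -0#≈0#
  coeff-neg (b ∷ p) zero = refl
  coeff-neg (b ∷ p) (suc n) = coeff-neg p n

  +ₚ-cong : ∀ {p p′ q q′} → p ≈ₚ p′ → q ≈ₚ q′ → (p +ₚ q) ≈ₚ (p′ +ₚ q′)
  +ₚ-cong {p} {p′} {q} {q′} e f = coeff⇒≈ₚ λ n → begin
    coeff (p +ₚ q) n          ≈⟨ coeff-+ p q n ⟩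
    coeff p n + coeff q n     ≈⟨ +-cong (≈ₚ⇒coeff e n) (≈ₚ⇒coeff f n) ⟩
    coeff p′ n + coeff q′ n   ≈⟨ coeff-+ p′ q′ n ⟨
    coeff (p′ +ₚ q′) n        ∎
    where open import Relation.Binary.Reasoning.Setoid setoid

  +ₚ-comm : ∀ p q → (p +ₚ q) ≈ₚ (q +ₚ p)
  +ₚ-comm p q = coeff⇒≈ₚ λ n →
    trans (coeff-+ p q n) (trans (+-comm _ _) (sym (coeff-+ q p n)))

  +ₚ-assoc : ∀ p q r → ((p +ₚ q) +ₚ r) ≈ₚ (p +ₚ (q +ₚ r))
  +ₚ-assoc p q r = coeff⇒≈ₚ λ n → begin
    coeff ((p +ₚ q) +ₚ r) n              ≈⟨ trans (coeff-+ (p +ₚ q) r n) (+-congʳ (coeff-+ p q n)) ⟩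
    (coeff p n + coeff q n) + coeff r n  ≈⟨ +-assoc _ _ _ ⟩
    coeff p n + (coeff q n + coeff r n)  ≈⟨ trans (coeff-+ p (q +ₚ r) n) (+-congˡ (coeff-+ q r n)) ⟨
    coeff (p +ₚ (q +ₚ r)) n              ∎
    where open import Relation.Binary.Reasoning.Setoid setoid

  +ₚ-identityʳ : ∀ p → (p +ₚ []) ≈ₚ p
  +ₚ-identityʳ p = coeff⇒≈ₚ λ n → trans (coeff-+ p [] n) (+-identityʳ _)

  negₚ-cong : ∀ {p q} → p ≈ₚ q → negₚ p ≈ₚ negₚ q
  negₚ-cong {p} {q} e = coeff⇒≈ₚ λ n →
    trans (coeff-neg p n) (trans (-‿cong (≈ₚ⇒coeff e n)) (sym (coeff-neg q n)))

  negₚ-inverseˡ : ∀ p → (negₚ p +ₚ p) ≈ₚ []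
  negₚ-inverseˡ p = coeff⇒≈ₚ λ n →
    trans (coeff-+ (negₚ p) p n) (trans (+-congʳ (coeff-neg p n)) (-‿inverseˡ _))

  +ₚ-interchange : ∀ w x y u → ((w +ₚ x) +ₚ (y +ₚ u)) ≈ₚ ((w +ₚ y) +ₚ (x +ₚ u))
  +ₚ-interchange w x y u = coeff⇒≈ₚ λ n → begin
    coeff ((w +ₚ x) +ₚ (y +ₚ u)) n
      ≈⟨ trans (coeff-+ (w +ₚ x) (y +ₚ u) n) (+-cong (coeff-+ w x n) (coeff-+ y u n)) ⟩
    (coeff w n + coeff x n) + (coeff y n + coeff u n)
      ≈⟨ solve 4 (λ w x y u → (w :+ x) :+ (y :+ u) := (w :+ y) :+ (x :+ u)) refl _ _ _ _ ⟩
    (coeff w n + coeff y n) + (coeff x n + coeff u n)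
      ≈⟨ trans (coeff-+ (w +ₚ y) (x +ₚ u) n) (+-cong (coeff-+ w y n) (coeff-+ x u n)) ⟨
    coeff ((w +ₚ y) +ₚ (x +ₚ u)) n ∎
    where
    open import Relation.Binary.Reasoning.Setoid setoid
    open IntegerSolver R using (solve; _:+_; _:=_)

  scale-cong : ∀ {a b p q} → a ≈ b → p ≈ₚ q → scale a p ≈ₚ scale b q
  scale-cong {a} {b} {p} {q} e f = coeff⇒≈ₚ λ n →
    trans (coeff-scale a p n) (trans (*-cong e (≈ₚ⇒coeff f n)) (sym (coeff-scale b q n)))

  scale-+ₚ : ∀ a p q → scale a (p +ₚ q) ≈ₚ (scale a p +ₚ scale a q)
  scale-+ₚ a p q = coeff⇒≈ₚ λ n → begin
    coeff (scale a (p +ₚ q)) n                ≈⟨ trans (coeff-scale a (p +ₚ q) n) (*-congˡ (coeff-+ p q n)) ⟩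
    a * (coeff p n + coeff q n)               ≈⟨ distribˡ _ _ _ ⟩
    a * coeff p n + a * coeff q n             ≈⟨ trans (coeff-+ (scale a p) (scale a q) n) (+-cong (coeff-scale a p n) (coeff-scale a q n)) ⟨
    coeff (scale a p +ₚ scale a q) n          ∎
    where open import Relation.Binary.Reasoning.Setoid setoid

  +-scale : ∀ a b p → scale (a + b) p ≈ₚ (scale a p +ₚ scale b p)
  +-scale a b p = coeff⇒≈ₚ λ n → begin
    coeff (scale (a + b) p) n                 ≈⟨ coeff-scale (a + b) p n ⟩
    (a + b) * coeff p n                       ≈⟨ distribʳ _ _ _ ⟩
    a * coeff p n + b * coeff p n             ≈⟨ trans (coeff-+ (scale a p) (scale b p) n) (+-cong (coeff-scale a p n) (coeff-scale b p n)) ⟨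
    coeff (scale a p +ₚ scale b p) n          ∎
    where open import Relation.Binary.Reasoning.Setoid setoid

  scale-scale : ∀ a b p → scale a (scale b p) ≈ₚ scale (a * b) p
  scale-scale a b p = coeff⇒≈ₚ λ n →
    trans (coeff-scale a (scale b p) n) (trans (*-congˡ (coeff-scale b p n))
      (trans (sym (*-assoc _ _ _)) (sym (coeff-scale (a * b) p n))))

  scale-0 : ∀ {a} p → a ≈ 0# → scale a p ≈ₚ []
  scale-0 {a} p a≈0 = coeff⇒≈ₚ λ n → trans (coeff-scale a p n) (trans (*-congʳ a≈0) (zeroˡ _))

  scale-1 : ∀ p → scale 1# p ≈ₚ p
  scale-1 p = coeff⇒≈ₚ λ n → trans (coeff-scale 1# p n) (*-identityˡ _)

  *ₚ-congˡ : ∀ {p p′} q → p ≈ₚ p′ → (p *ₚ q) ≈ₚ (p′ *ₚ q)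
  *ₚ-congˡ q []≈[] = []≈[]
  *ₚ-congˡ q ([]≈∷ b≈0 e) =
    ≈ₚ-sym (≈ₚ-trans (+ₚ-cong (scale-0 q b≈0) ≈ₚ-refl) (∷≈[] refl (≈ₚ-sym (*ₚ-congˡ q e))))
  *ₚ-congˡ q (∷≈[] a≈0 e) = ≈ₚ-trans (+ₚ-cong (scale-0 q a≈0) ≈ₚ-refl) (∷≈[] refl (*ₚ-congˡ q e))
  *ₚ-congˡ q (∷≈∷ a≈b e) = +ₚ-cong (scale-cong a≈b ≈ₚ-refl) (∷≈∷ refl (*ₚ-congˡ q e))

  *ₚ-congʳ : ∀ p {q q′} → q ≈ₚ q′ → (p *ₚ q) ≈ₚ (p *ₚ q′)
  *ₚ-congʳ [] e = []≈[]
  *ₚ-congʳ (a ∷ p) e = +ₚ-cong (scale-cong refl e) (∷≈∷ refl (*ₚ-congʳ p e))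

  *ₚ-distribʳ : ∀ p q r → ((p +ₚ q) *ₚ r) ≈ₚ ((p *ₚ r) +ₚ (q *ₚ r))
  *ₚ-distribʳ [] q r = ≈ₚ-refl
  *ₚ-distribʳ (a ∷ p) [] r = ≈ₚ-sym (+ₚ-identityʳ _)
  *ₚ-distribʳ (a ∷ p) (b ∷ q) r = begin
      scale (a + b) r +ₚ (0# ∷ ((p +ₚ q) *ₚ r))
    ≈⟨ +ₚ-cong (+-scale a b r) (∷≈∷ (sym (+-identityˡ _)) (*ₚ-distribʳ p q r)) ⟩
      (scale a r +ₚ scale b r) +ₚ ((0# ∷ (p *ₚ r)) +ₚ (0# ∷ (q *ₚ r)))
    ≈⟨ +ₚ-interchange (scale a r) (scale b r) (0# ∷ (p *ₚ r)) (0# ∷ (q *ₚ r)) ⟩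
      (scale a r +ₚ (0# ∷ (p *ₚ r))) +ₚ (scale b r +ₚ (0# ∷ (q *ₚ r))) ∎
    where open import Relation.Binary.Reasoning.Setoid ≈ₚ-setoid

  *ₚ-distribˡ : ∀ r p q → (r *ₚ (p +ₚ q)) ≈ₚ ((r *ₚ p) +ₚ (r *ₚ q))
  *ₚ-distribˡ [] p q = ≈ₚ-refl
  *ₚ-distribˡ (a ∷ r) p q = begin
      scale a (p +ₚ q) +ₚ (0# ∷ (r *ₚ (p +ₚ q)))
    ≈⟨ +ₚ-cong (scale-+ₚ a p q) (∷≈∷ (sym (+-identityˡ 0#)) (*ₚ-distribˡ r p q)) ⟩
      (scale a p +ₚ scale a q) +ₚ ((0# ∷ (r *ₚ p)) +ₚ (0# ∷ (r *ₚ q)))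
    ≈⟨ +ₚ-interchange (scale a p) (scale a q) (0# ∷ (r *ₚ p)) (0# ∷ (r *ₚ q)) ⟩
      (scale a p +ₚ (0# ∷ (r *ₚ p))) +ₚ (scale a q +ₚ (0# ∷ (r *ₚ q))) ∎
    where open import Relation.Binary.Reasoning.Setoid ≈ₚ-setoid

  scale-*ₚ : ∀ a p q → (scale a p *ₚ q) ≈ₚ scale a (p *ₚ q)
  scale-*ₚ a [] q = ≈ₚ-refl
  scale-*ₚ a (b ∷ p) q = ≈ₚ-trans
    (+ₚ-cong (≈ₚ-sym (scale-scale a b q)) (∷≈∷ (sym (zeroʳ a)) (scale-*ₚ a p q)))
    (≈ₚ-sym (scale-+ₚ a (scale b q) (0# ∷ (p *ₚ q))))

  *ₚ-assoc : ∀ p q r → ((p *ₚ q) *ₚ r) ≈ₚ (p *ₚ (q *ₚ r))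
  *ₚ-assoc [] q r = ≈ₚ-refl
  *ₚ-assoc (a ∷ p) q r = ≈ₚ-trans (*ₚ-distribʳ (scale a q) (0# ∷ (p *ₚ q)) r)
    (+ₚ-cong (scale-*ₚ a q r) (+ₚ-cong (scale-0 r refl) (∷≈∷ refl (*ₚ-assoc p q r))))

  *ₚ-∷ : ∀ p b q → (p *ₚ (b ∷ q)) ≈ₚ (scale b p +ₚ (0# ∷ (p *ₚ q)))
  *ₚ-∷ [] b q = []≈∷ refl []≈[]
  *ₚ-∷ (a ∷ p) b q = ∷≈∷ (+-congʳ (*-comm a b)) (begin
      scale a q +ₚ (p *ₚ (b ∷ q))
    ≈⟨ +ₚ-cong ≈ₚ-refl (*ₚ-∷ p b q) ⟩
      scale a q +ₚ (scale b p +ₚ (0# ∷ (p *ₚ q)))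
    ≈⟨ +ₚ-assoc (scale a q) (scale b p) _ ⟨
      (scale a q +ₚ scale b p) +ₚ (0# ∷ (p *ₚ q))
    ≈⟨ +ₚ-cong (+ₚ-comm (scale a q) (scale b p)) ≈ₚ-refl ⟩
      (scale b p +ₚ scale a q) +ₚ (0# ∷ (p *ₚ q))
    ≈⟨ +ₚ-assoc (scale b p) (scale a q) _ ⟩
      scale b p +ₚ (scale a q +ₚ (0# ∷ (p *ₚ q))) ∎)
    where open import Relation.Binary.Reasoning.Setoid ≈ₚ-setoid

  *ₚ-comm : ∀ p q → (p *ₚ q) ≈ₚ (q *ₚ p)
  *ₚ-comm p [] = *ₚ-zeroʳ p
    where
    *ₚ-zeroʳ : ∀ p → (p *ₚ []) ≈ₚ []
    *ₚ-zeroʳ [] = []≈[]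
    *ₚ-zeroʳ (a ∷ p) = ∷≈[] refl (*ₚ-zeroʳ p)
  *ₚ-comm p (b ∷ q) = ≈ₚ-trans (*ₚ-∷ p b q) (+ₚ-cong ≈ₚ-refl (∷≈∷ refl (*ₚ-comm p q)))

  *ₚ-identityˡ : ∀ p → (oneₚ *ₚ p) ≈ₚ p
  *ₚ-identityˡ p = ≈ₚ-trans (+ₚ-cong (scale-1 p) (∷≈[] refl []≈[])) (+ₚ-identityʳ p)

  PolyRing : CommutativeRing c (c ⊔ ℓ)
  PolyRing = record
    { Carrier = Poly ; _≈_ = _≈ₚ_ ; _+_ = _+ₚ_ ; _*_ = _*ₚ_ ; -_ = negₚ ; 0# = [] ; 1# = oneₚ
    ; isCommutativeRing = record
      { isRing = record
        { +-isAbelianGroup = record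
          { isGroup = record
            { isMonoid = record
              { isSemigroup = record
                { isMagma = record { isEquivalence = ≈ₚ-isEquivalence ; ∙-cong = +ₚ-cong }
                ; assoc = +ₚ-assoc }
              ; identity = (λ p → ≈ₚ-refl) , +ₚ-identityʳ }
            ; inverse = negₚ-inverseˡ , (λ p → ≈ₚ-trans (+ₚ-comm p (negₚ p)) (negₚ-inverseˡ p))
            ; ⁻¹-cong = negₚ-cong }
          ; comm = +ₚ-comm }
        ; *-cong = λ {p} {p′} {q} {q′} e f → ≈ₚ-trans (*ₚ-congˡ q e) (*ₚ-congʳ p′ f)
        ; *-assoc = *ₚ-assoc
        ; *-identity = *ₚ-identityˡ , (λ p → ≈ₚ-trans (*ₚ-comm p oneₚ) (*ₚ-identityˡ p))
        ; distrib = *ₚ-distribˡ , (λ r p q → *ₚ-distribʳ p q r) }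
      ; *-comm = *ₚ-comm } }

module TwoGeneratorIdeals {c ℓ : Level} (A : CommutativeRing c ℓ) where
  open CommutativeRing A
  open import Relation.Binary.Reasoning.Setoid setoid
  open IntegerSolver A using (solve; _:+_; _:*_; _:=_; :1; :0)

  infix 4 _∈⟨_,_⟩
  _∈⟨_,_⟩ : Carrier → Carrier → Carrier → Set (c ⊔ ℓ)
  h ∈⟨ f , g ⟩ = ∃ λ a → ∃ λ b → h ≈ a * f + b * g

  ⟨_,_⟩≐⟨_,_⟩ : Carrier → Carrier → Carrier → Carrier → Set (c ⊔ ℓ)
  ⟨ f , g ⟩≐⟨ f′ , g′ ⟩ = ∀ h → h ∈⟨ f , g ⟩ ⇔ h ∈⟨ f′ , g′ ⟩

  module _ {f g : Carrier} where

    ∈-resp-≈ : ∀ {h h′} → h ≈ h′ → h ∈⟨ f , g ⟩ → h′ ∈⟨ f , g ⟩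
    ∈-resp-≈ h≈h′ (a , b , h≈) = a , b , trans (sym h≈h′) h≈

    ∈-left : f ∈⟨ f , g ⟩
    ∈-left = 1# , 0# , solve 2 (λ f g → f := :1 :* f :+ :0 :* g) refl f g

    ∈-right : g ∈⟨ f , g ⟩
    ∈-right = 0# , 1# , solve 2 (λ f g → g := :0 :* f :+ :1 :* g) refl f g

    ∈-lincomb : ∀ {h₁ h₂} k₁ k₂ → h₁ ∈⟨ f , g ⟩ → h₂ ∈⟨ f , g ⟩ → k₁ * h₁ + k₂ * h₂ ∈⟨ f , g ⟩
    ∈-lincomb {h₁} {h₂} k₁ k₂ (a₁ , b₁ , e₁) (a₂ , b₂ , e₂) =
      k₁ * a₁ + k₂ * a₂ , k₁ * b₁ + k₂ * b₂ , (begin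
        k₁ * h₁ + k₂ * h₂                               ≈⟨ +-cong (*-congˡ e₁) (*-congˡ e₂) ⟩
        k₁ * (a₁ * f + b₁ * g) + k₂ * (a₂ * f + b₂ * g)
          ≈⟨ solve 8 (λ k₁ k₂ a₁ b₁ a₂ b₂ f g →
                k₁ :* (a₁ :* f :+ b₁ :* g) :+ k₂ :* (a₂ :* f :+ b₂ :* g)
             := (k₁ :* a₁ :+ k₂ :* a₂) :* f :+ (k₁ :* b₁ :+ k₂ :* b₂) :* g) refl k₁ k₂ a₁ b₁ a₂ b₂ f g ⟩
        (k₁ * a₁ + k₂ * a₂) * f + (k₁ * b₁ + k₂ * b₂) * g ∎)

    ∈-*ʳ : ∀ {h} k → h ∈⟨ f , g ⟩ → h * k ∈⟨ f , g ⟩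
    ∈-*ʳ {h} k (a , b , e) = a * k , b * k , (begin
      h * k                       ≈⟨ *-congʳ e ⟩
      (a * f + b * g) * k         ≈⟨ solve 5 (λ a b f g k → (a :* f :+ b :* g) :* k := a :* k :* f :+ b :* k :* g) refl a b f g k ⟩
      a * k * f + b * k * g       ∎)

    ∈-generated : ∀ {f′ g′ h} → f′ ∈⟨ f , g ⟩ → g′ ∈⟨ f , g ⟩ → h ∈⟨ f′ , g′ ⟩ → h ∈⟨ f , g ⟩
    ∈-generated f′∈ g′∈ (a , b , e) = ∈-resp-≈ (sym e) (∈-lincomb a b f′∈ g′∈)

    ∈-by-comaximal : ∀ {u v q} → 1# ∈⟨ u , v ⟩ → u * q ∈⟨ f , g ⟩ → v * q ∈⟨ f , g ⟩ → q ∈⟨ f , g ⟩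
    ∈-by-comaximal {u} {v} {q} (x , y , 1≈) uq∈ vq∈ = ∈-resp-≈ q≈ (∈-lincomb x y uq∈ vq∈)
      where
      q≈ : x * (u * q) + y * (v * q) ≈ q
      q≈ = begin
        x * (u * q) + y * (v * q)   ≈⟨ solve 5 (λ x u y v q → x :* (u :* q) :+ y :* (v :* q) := (x :* u :+ y :* v) :* q) refl x u y v q ⟩
        (x * u + y * v) * q         ≈⟨ *-congʳ 1≈ ⟨
        1# * q                      ≈⟨ *-identityˡ q ⟩
        q                           ∎

  ≐-intro : ∀ {f g f′ g′} → f′ ∈⟨ f , g ⟩ → g′ ∈⟨ f , g ⟩ → f ∈⟨ f′ , g′ ⟩ → g ∈⟨ f′ , g′ ⟩
          → ⟨ f , g ⟩≐⟨ f′ , g′ ⟩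
  ≐-intro f′∈ g′∈ f∈ g∈ h = mk⇔ (∈-generated f∈ g∈) (∈-generated f′∈ g′∈)

  ≐-trans : ∀ {f g f′ g′ f″ g″} → ⟨ f , g ⟩≐⟨ f′ , g′ ⟩ → ⟨ f′ , g′ ⟩≐⟨ f″ , g″ ⟩ → ⟨ f , g ⟩≐⟨ f″ , g″ ⟩
  ≐-trans I≐J J≐K h = mk⇔ (Equivalence.to (J≐K h) ∘′ Equivalence.to (I≐J h)) (Equivalence.from (I≐J h) ∘′ Equivalence.from (J≐K h))

  comaximal-* : ∀ {a b d} → 1# ∈⟨ a , d ⟩ → 1# ∈⟨ b , d ⟩ → 1# ∈⟨ a * b , d ⟩
  comaximal-* {a} {b} {d} ad bd = ∈-by-comaximal bd (∈-resp-≈ (sym (*-identityʳ b)) b∈) (∈-resp-≈ (sym (*-identityʳ d)) ∈-right)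
    where
    b∈ : b ∈⟨ a * b , d ⟩
    b∈ = ∈-by-comaximal ad ∈-left (∈-*ʳ b ∈-right)

  comaximal-shift : ∀ {a a′ d} k → a ≈ a′ + k * d → 1# ∈⟨ a , d ⟩ → 1# ∈⟨ a′ , d ⟩
  comaximal-shift {a} {a′} {d} k a≈ (x , y , 1≈) = x , x * k + y , (begin
    1#                            ≈⟨ 1≈ ⟩
    x * a + y * d                 ≈⟨ +-congʳ (*-congˡ a≈) ⟩
    x * (a′ + k * d) + y * d      ≈⟨ solve 5 (λ x a′ k d y → x :* (a′ :+ k :* d) :+ y :* d := x :* a′ :+ (x :* k :+ y) :* d) refl x a′ k d y ⟩
    x * a′ + (x * k + y) * d      ∎)

-- An even-part operator on a commutative ring A: a congruence ev such that
-- ev (x y) = ev x · ev y + od x · od y, where od x = x - ev x is the odd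
-- part.  On R[z] this is P ↦ P_even.
record EvenPart {c ℓ : Level} (A : CommutativeRing c ℓ) : Set (c ⊔ ℓ) where
  open CommutativeRing A
  field
    ev : Carrier → Carrier
    ev-cong : ∀ {x y} → x ≈ y → ev x ≈ ev y
    ev-* : ∀ x y → ev (x * y) ≈ ev x * ev y + (x - ev x) * (y - ev y)

module EvenPartTheory {c ℓ : Level} {A : CommutativeRing c ℓ} (E : EvenPart A) where
  open CommutativeRing A
  open EvenPart E
  open TwoGeneratorIdeals A
  open IntegerSolver A using (solve; _:+_; _:*_; _:-_; :-_; _:=_; :1)
  open import Relation.Binary.Reasoning.Setoid setoid

  infix 4 _∼_
  _∼_ : Carrier → Carrier → Set (c ⊔ ℓ)
  P ∼ Q = ⟨ P , ev P ⟩≐⟨ Q , ev Q ⟩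

  ≈⇒∼ : ∀ {P Q} → P ≈ Q → P ∼ Q
  ≈⇒∼ P≈Q = ≐-intro (∈-resp-≈ P≈Q ∈-left) (∈-resp-≈ (ev-cong P≈Q) ∈-right)
                    (∈-resp-≈ (sym P≈Q) ∈-left) (∈-resp-≈ (sym (ev-cong P≈Q)) ∈-right)

  ∼-trans : ∀ {P Q S} → P ∼ Q → Q ∼ S → P ∼ S
  ∼-trans = ≐-trans

  -- A factor L with ev L = 1, i.e. L = 1 + t with t = L - ev L odd;
  -- on R[z] the factors 1 - Y z.
  module Factor (L : Carrier) (ev-L : ev L ≈ 1#) where

    t : Carrier
    t = L - ev L

    L≈1+t : L ≈ 1# + t
    L≈1+t = begin
      L                 ≈⟨ solve 2 (λ L e → L := e :+ (L :- e)) refl L (ev L) ⟩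
      ev L + (L - ev L) ≈⟨ +-congʳ ev-L ⟩
      1# + t            ∎

    -- φ P = ev (L P) = ev P + t · od P; modulo D = 1 - t², the map φ is
    -- multiplicative (φ-*), since t² ≡ 1
    φ : Carrier → Carrier
    φ P = ev (L * P)

    D : Carrier
    D = 1# - t * t

    φ≈ : ∀ P → φ P ≈ ev P + t * (P - ev P)
    φ≈ P = begin
      ev (L * P)                                  ≈⟨ ev-* L P ⟩
      ev L * ev P + (L - ev L) * (P - ev P)       ≈⟨ +-congʳ (*-congʳ ev-L) ⟩
      1# * ev P + t * (P - ev P)                  ≈⟨ +-congʳ (*-identityˡ (ev P)) ⟩
      ev P + t * (P - ev P)                       ∎

    φ-* : ∀ P Q → φ P * φ Q ≈ φ (P * Q) + - ((P - ev P) * (Q - ev Q)) * D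
    φ-* P Q = begin
      φ P * φ Q
        ≈⟨ *-cong (φ≈ P) (φ≈ Q) ⟩
      (ev P + t * (P - ev P)) * (ev Q + t * (Q - ev Q))
        ≈⟨ solve 5 (λ P Q p q t →
              (p :+ t :* (P :- p)) :* (q :+ t :* (Q :- q))
           := (p :* q :+ (P :- p) :* (Q :- q)) :+ t :* (P :* Q :- (p :* q :+ (P :- p) :* (Q :- q)))
              :+ :- ((P :- p) :* (Q :- q)) :* (:1 :- t :* t)) refl P Q (ev P) (ev Q) t ⟩
      ev P * ev Q + (P - ev P) * (Q - ev Q) + t * (P * Q - (ev P * ev Q + (P - ev P) * (Q - ev Q)))
          + - ((P - ev P) * (Q - ev Q)) * D
        ≈⟨ +-congʳ (+-cong (sym (ev-* P Q)) (*-congˡ (+-congˡ (-‿cong (sym (ev-* P Q)))))) ⟩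
      ev (P * Q) + t * (P * Q - ev (P * Q)) + - ((P - ev P) * (Q - ev Q)) * D
        ≈⟨ +-congʳ (φ≈ (P * Q)) ⟨
      φ (P * Q) + - ((P - ev P) * (Q - ev Q)) * D
        ∎

    -- P is coprime to the conjugate 1 - t of L, in the sense that φ P and
    -- D = (1 - t) L generate the unit ideal
    Coprime : Carrier → Set (c ⊔ ℓ)
    Coprime P = 1# ∈⟨ φ P , D ⟩

    coprime-1 : Coprime 1#
    coprime-1 = ∈-resp-≈ φ1≈1 ∈-left
      where
      φ1≈1 : φ 1# ≈ 1#
      φ1≈1 = trans (ev-cong (*-identityʳ L)) ev-L

    coprime-* : ∀ {P Q} → Coprime P → Coprime Q → Coprime (P * Q)
    coprime-* {P} {Q} cP cQ = comaximal-shift _ (φ-* P Q) (comaximal-* cP cQ)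

    strip : ∀ {P} → Coprime P → L * P ∼ P
    strip {P} cop = ≐-intro P∈ evP∈ LP∈ φP∈
      where
      φP∈ : φ P ∈⟨ P , ev P ⟩
      φP∈ = t , 1# - t , (begin
        φ P                       ≈⟨ φ≈ P ⟩
        ev P + t * (P - ev P)     ≈⟨ solve 3 (λ P p t → p :+ t :* (P :- p) := t :* P :+ (:1 :- t) :* p) refl P (ev P) t ⟩
        t * P + (1# - t) * ev P   ∎)

      LP∈ : L * P ∈⟨ P , ev P ⟩
      LP∈ = ∈-resp-≈ (*-comm P L) (∈-*ʳ L ∈-left)

      P∈ : P ∈⟨ L * P , φ P ⟩
      P∈ = ∈-by-comaximal cop (∈-*ʳ P ∈-right) (∈-resp-≈ DP≈ (∈-*ʳ (1# - t) ∈-left))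
        where
        DP≈ : L * P * (1# - t) ≈ D * P
        DP≈ = begin
          L * P * (1# - t)          ≈⟨ *-congʳ (*-congʳ L≈1+t) ⟩
          (1# + t) * P * (1# - t)   ≈⟨ solve 2 (λ P t → (:1 :+ t) :* P :* (:1 :- t) := (:1 :- t :* t) :* P) refl P t ⟩
          D * P                     ∎

      evP∈ : ev P ∈⟨ L * P , φ P ⟩
      evP∈ = ∈-by-comaximal cop (∈-*ʳ (ev P) ∈-right) (∈-resp-≈ Dp≈ (∈-lincomb (- t) (1# + t) ∈-left ∈-right))
        where
        Dp≈ : - t * (L * P) + (1# + t) * φ P ≈ D * ev P
        Dp≈ = begin
          - t * (L * P) + (1# + t) * φ P
            ≈⟨ +-cong (*-congˡ (*-congʳ L≈1+t)) (*-congˡ (φ≈ P)) ⟩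
          - t * ((1# + t) * P) + (1# + t) * (ev P + t * (P - ev P))
            ≈⟨ solve 3 (λ P p t → :- t :* ((:1 :+ t) :* P) :+ (:1 :+ t) :* (p :+ t :* (P :- p)) := (:1 :- t :* t) :* p) refl P (ev P) t ⟩
          D * ev P ∎

module PolynomialParity {c ℓ : Level} (R : CommutativeRing c ℓ) where
  open CommutativeRing R hiding (zero)
  open RingDefs R
  open PolynomialRing R
  open IntegerSolver PolyRing using (solve; _:+_; _:*_; _:-_; _:=_)
  open import Relation.Binary.Reasoning.Setoid ≈ₚ-setoid

  private
    E O : Poly → Poly
    E = evenPart
    O = oddZero

  E-cong : ∀ {p q} → p ≈ₚ q → E p ≈ₚ E q
  O-cong : ∀ {p q} → p ≈ₚ q → O p ≈ₚ O q
  E-cong []≈[] = []≈[]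
  E-cong ([]≈∷ b≈0 e) = []≈∷ b≈0 (O-cong e)
  E-cong (∷≈[] a≈0 e) = ∷≈[] a≈0 (O-cong e)
  E-cong (∷≈∷ a≈b e) = ∷≈∷ a≈b (O-cong e)
  O-cong []≈[] = []≈[]
  O-cong ([]≈∷ b≈0 e) = []≈∷ refl (E-cong e)
  O-cong (∷≈[] a≈0 e) = ∷≈[] refl (E-cong e)
  O-cong (∷≈∷ a≈b e) = ∷≈∷ refl (E-cong e)

  E-+ : ∀ p q → E (p +ₚ q) ≈ₚ (E p +ₚ E q)
  O-+ : ∀ p q → O (p +ₚ q) ≈ₚ (O p +ₚ O q)
  E-+ [] q = ≈ₚ-refl
  E-+ (a ∷ p) [] = ≈ₚ-sym (+ₚ-identityʳ _)
  E-+ (a ∷ p) (b ∷ q) = ∷≈∷ refl (O-+ p q)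
  O-+ [] q = ≈ₚ-refl
  O-+ (a ∷ p) [] = ≈ₚ-sym (+ₚ-identityʳ _)
  O-+ (a ∷ p) (b ∷ q) = ∷≈∷ (sym (+-identityˡ 0#)) (E-+ p q)

  E-scale : ∀ a p → E (scale a p) ≈ₚ scale a (E p)
  O-scale : ∀ a p → O (scale a p) ≈ₚ scale a (O p)
  E-scale a [] = []≈[]
  E-scale a (b ∷ p) = ∷≈∷ refl (O-scale a p)
  O-scale a [] = []≈[]
  O-scale a (b ∷ p) = ∷≈∷ (sym (zeroʳ a)) (E-scale a p)

  E+O : ∀ p → p ≈ₚ (E p +ₚ O p)
  E+O [] = []≈[]
  E+O (a ∷ p) = ∷≈∷ (sym (+-identityʳ a)) (≈ₚ-trans (E+O p) (+ₚ-comm (E p) (O p)))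

  zP : Poly
  zP = 0# ∷ 1# ∷ []

  [_]ₚ : Carrier → Poly
  [ a ]ₚ = a ∷ []

  0∷≈z* : ∀ p → (0# ∷ p) ≈ₚ (zP *ₚ p)
  0∷≈z* p = ≈ₚ-sym (+ₚ-cong (scale-0 p refl) (∷≈∷ refl (*ₚ-identityˡ p)))

  scale≈[]* : ∀ a p → scale a p ≈ₚ ([ a ]ₚ *ₚ p)
  scale≈[]* a p = ≈ₚ-sym (≈ₚ-trans (+ₚ-cong (≈ₚ-refl {scale a p}) (∷≈[] refl []≈[])) (+ₚ-identityʳ (scale a p)))

  ∷≈[]+z* : ∀ a p → (a ∷ p) ≈ₚ ([ a ]ₚ +ₚ (zP *ₚ p))
  ∷≈[]+z* a p = ≈ₚ-trans (∷≈∷ (sym (+-identityʳ a)) ≈ₚ-refl) (+ₚ-cong (≈ₚ-refl {[ a ]ₚ}) (0∷≈z* p))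

  E-* : ∀ p q → E (p *ₚ q) ≈ₚ ((E p *ₚ E q) +ₚ (O p *ₚ O q))
  O-* : ∀ p q → O (p *ₚ q) ≈ₚ ((E p *ₚ O q) +ₚ (O p *ₚ E q))
  E-* [] q = ≈ₚ-refl
  E-* (a ∷ p) q = begin
      E (scale a q +ₚ (0# ∷ (p *ₚ q)))
    ≈⟨ E-+ (scale a q) _ ⟩
      E (scale a q) +ₚ (0# ∷ O (p *ₚ q))
    ≈⟨ +ₚ-cong (≈ₚ-trans (E-scale a q) (scale≈[]* a (E q))) (≈ₚ-trans (∷≈∷ refl (O-* p q)) (0∷≈z* _)) ⟩
      ([ a ]ₚ *ₚ E q) +ₚ (zP *ₚ ((E p *ₚ O q) +ₚ (O p *ₚ E q)))
    ≈⟨ solve 6 (λ A z ep op eq oq → A :* eq :+ z :* (ep :* oq :+ op :* eq)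
                   := (A :+ z :* op) :* eq :+ (z :* ep) :* oq) ≈ₚ-refl [ a ]ₚ zP (E p) (O p) (E q) (O q) ⟩
      (([ a ]ₚ +ₚ (zP *ₚ O p)) *ₚ E q) +ₚ ((zP *ₚ E p) *ₚ O q)
    ≈⟨ +ₚ-cong (*ₚ-congˡ (E q) (≈ₚ-sym (∷≈[]+z* a (O p)))) (*ₚ-congˡ (O q) (≈ₚ-sym (0∷≈z* (E p)))) ⟩
      ((a ∷ O p) *ₚ E q) +ₚ ((0# ∷ E p) *ₚ O q) ∎
  O-* [] q = ≈ₚ-refl
  O-* (a ∷ p) q = begin
      O (scale a q +ₚ (0# ∷ (p *ₚ q)))
    ≈⟨ O-+ (scale a q) _ ⟩
      O (scale a q) +ₚ (0# ∷ E (p *ₚ q))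
    ≈⟨ +ₚ-cong (≈ₚ-trans (O-scale a q) (scale≈[]* a (O q))) (≈ₚ-trans (∷≈∷ refl (E-* p q)) (0∷≈z* _)) ⟩
      ([ a ]ₚ *ₚ O q) +ₚ (zP *ₚ ((E p *ₚ E q) +ₚ (O p *ₚ O q)))
    ≈⟨ solve 6 (λ A z ep op eq oq → A :* oq :+ z :* (ep :* eq :+ op :* oq)
                   := (A :+ z :* op) :* oq :+ (z :* ep) :* eq) ≈ₚ-refl [ a ]ₚ zP (E p) (O p) (E q) (O q) ⟩
      (([ a ]ₚ +ₚ (zP *ₚ O p)) *ₚ O q) +ₚ ((zP *ₚ E p) *ₚ E q)
    ≈⟨ +ₚ-cong (*ₚ-congˡ (O q) (≈ₚ-sym (∷≈[]+z* a (O p)))) (*ₚ-congˡ (E q) (≈ₚ-sym (0∷≈z* (E p)))) ⟩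
      ((a ∷ O p) *ₚ O q) +ₚ ((0# ∷ E p) *ₚ E q) ∎

  O≈ : ∀ p → O p ≈ₚ (p +ₚ negₚ (E p))
  O≈ p = begin
    O p                            ≈⟨ solve 2 (λ e o → o := (e :+ o) :- e) ≈ₚ-refl (E p) (O p) ⟩
    (E p +ₚ O p) +ₚ negₚ (E p)     ≈⟨ +ₚ-cong (E+O p) ≈ₚ-refl ⟨
    p +ₚ negₚ (E p)                ∎

  evenPart-operator : EvenPart PolyRing
  evenPart-operator = record
    { ev = evenPart
    ; ev-cong = E-cong
    ; ev-* = λ p q → ≈ₚ-trans (E-* p q) (+ₚ-cong ≈ₚ-refl (CommutativeRing.*-cong PolyRing (O≈ p) (O≈ q)))
    }

module LinearFactors {c ℓ : Level} (R : CommutativeRing c ℓ) where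
  open CommutativeRing R hiding (zero)
  open RingDefs R
  open PolynomialRing R
  open PolynomialParity R
  open EvenPartTheory evenPart-operator
  open TwoGeneratorIdeals PolyRing using (_∈⟨_,_⟩)

  E-lin : ∀ Y → evenPart (lin Y) ≈ₚ oneₚ
  E-lin Y = ∷≈∷ refl (∷≈[] refl []≈[])

  module Lin (Y : Carrier) = Factor (lin Y) (E-lin Y)
  open Lin using (Coprime)

  u : Poly
  u = 0# ∷ - 1# ∷ []

  t≈[Y]u : ∀ Y → Lin.t Y ≈ₚ ([ Y ]ₚ *ₚ u)
  t≈[Y]u Y = ∷≈∷ (solve 1 (λ Y → :1 :- :1 := Y :* :0 :+ :0) refl Y)
                 (∷≈∷ (solve 1 (λ Y → :- Y :- :0 := Y :* :- :1) refl Y) []≈[])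
    where open IntegerSolver R using (solve; _:+_; _:*_; _:-_; :-_; _:=_; :1; :0)

  coprime-lin : ∀ {Y Y′} → IsUnit (Y + Y′) → Coprime Y (lin Y′)
  coprime-lin {Y} {Y′} (w , Y+Y′*w≈1) = [ Y ]ₚ *ₚ [ w ]ₚ , [ Y′ ]ₚ *ₚ [ w ]ₚ , (begin
      oneₚ
    ≈⟨ ∷≈∷ (trans (sym Y+Y′*w≈1) (sym (+-identityʳ _))) []≈[] ⟩
      ([ Y ]ₚ +ₚ [ Y′ ]ₚ) *ₚ [ w ]ₚ
    ≈⟨ solve 4 (λ y y′ u w → (y :+ y′) :* w
                := y :* w :* (:1 :+ y :* u :* (y′ :* u)) :+ y′ :* w :* (:1 :- y :* u :* (y :* u)))
         ≈ₚ-refl [ Y ]ₚ [ Y′ ]ₚ u [ w ]ₚ ⟩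
      (([ Y ]ₚ *ₚ [ w ]ₚ) *ₚ (oneₚ +ₚ (([ Y ]ₚ *ₚ u) *ₚ ([ Y′ ]ₚ *ₚ u))))
        +ₚ (([ Y′ ]ₚ *ₚ [ w ]ₚ) *ₚ (oneₚ +ₚ negₚ (([ Y ]ₚ *ₚ u) *ₚ ([ Y ]ₚ *ₚ u))))
    ≈⟨ +ₚ-cong (*ₚ-congʳ ([ Y ]ₚ *ₚ [ w ]ₚ) (+ₚ-cong (≈ₚ-sym (E-lin Y′)) (P.*-cong (≈ₚ-sym (t≈[Y]u Y)) (≈ₚ-sym (t≈[Y]u Y′)))))
               (*ₚ-congʳ ([ Y′ ]ₚ *ₚ [ w ]ₚ) (+ₚ-cong (≈ₚ-refl {oneₚ}) (negₚ-cong (P.*-cong (≈ₚ-sym (t≈[Y]u Y)) (≈ₚ-sym (t≈[Y]u Y)))))) ⟩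
      (([ Y ]ₚ *ₚ [ w ]ₚ) *ₚ (evenPart (lin Y′) +ₚ (Lin.t Y *ₚ Lin.t Y′)))
        +ₚ (([ Y′ ]ₚ *ₚ [ w ]ₚ) *ₚ Lin.D Y)
    ≈⟨ +ₚ-cong (*ₚ-congʳ ([ Y ]ₚ *ₚ [ w ]ₚ) (Lin.φ≈ Y (lin Y′))) (≈ₚ-refl {([ Y′ ]ₚ *ₚ [ w ]ₚ) *ₚ Lin.D Y}) ⟨
      (([ Y ]ₚ *ₚ [ w ]ₚ) *ₚ Lin.φ Y (lin Y′)) +ₚ (([ Y′ ]ₚ *ₚ [ w ]ₚ) *ₚ Lin.D Y) ∎)
    where
    module P = CommutativeRing PolyRing
    open import Relation.Binary.Reasoning.Setoid ≈ₚ-setoid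
    open IntegerSolver PolyRing using (solve; _:+_; _:*_; _:-_; _:=_; :1)

  coprime-^ : ∀ {Y P} n → Coprime Y P → Coprime Y (P ^ₚ n)
  coprime-^ {Y} zero cop = Lin.coprime-1 Y
  coprime-^ {Y} (suc n) cop = Lin.coprime-* Y cop (coprime-^ n cop)

  coprime-prodₚ : ∀ {Y} n (f : Fin n → Poly) → (∀ i → Coprime Y (f i)) → Coprime Y (prodₚ n f)
  coprime-prodₚ {Y} zero f cop = Lin.coprime-1 Y
  coprime-prodₚ {Y} (suc n) f cop =
    Lin.coprime-* Y (cop Fin.zero) (coprime-prodₚ n (λ i → f (Fin.suc i)) (λ i → cop (Fin.suc i)))

  -- The factors
  -- are peeled off from the front; a simple factor 1 - Y z is stripped,
  -- a double factor is absorbed into M.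
  reduce : ∀ r s (s≤r : s ≤ r) (a : Fin r → ℕ) (Y : Fin r → Carrier)
    → (∀ i → (a i ≡ 2 × toℕ i < s) ⊎ (a i ≡ 1 × s ≤ toℕ i))
    → (∀ i j → i ≢ j → IsUnit (Y i + Y j))
    → (M : Poly) → (∀ i → s ≤ toℕ i → Coprime (Y i) M)
    → (M *ₚ prodₚ r (λ i → lin (Y i) ^ₚ a i)) ∼ (M *ₚ prodₚ s (λ j → lin (Y (inject≤ j s≤r)) ^ₚ 2))
  reduce zero zero z≤n a Y shape units M cop = ≈⇒∼ ≈ₚ-refl
  reduce (suc r) zero z≤n a Y shape units M cop =
    ∼-trans (≈⇒∼ front) (∼-trans (Lin.strip Y₀ (Lin.coprime-* Y₀ (cop Fin.zero z≤n) rest-coprime)) IH)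
    where
    simple : ∀ i → a i ≡ 1
    simple i with shape i
    ... | inj₂ (aᵢ≡1 , _) = aᵢ≡1
    Y₀ : Carrier
    Y₀ = Y Fin.zero
    rest : Poly
    rest = prodₚ r (λ i → lin (Y (Fin.suc i)) ^ₚ a (Fin.suc i))
    front : (M *ₚ ((lin Y₀ ^ₚ a Fin.zero) *ₚ rest)) ≈ₚ (lin Y₀ *ₚ (M *ₚ rest))
    front = ≈ₚ-trans (*ₚ-congʳ M (*ₚ-congˡ rest (≈ₚ-reflexive (≡.cong (lin Y₀ ^ₚ_) (simple Fin.zero)))))
      (solve 3 (λ M L Q → M :* ((L :* :1) :* Q) := L :* (M :* Q)) ≈ₚ-refl M (lin Y₀) rest)
      where open IntegerSolver PolyRing using (solve; _:*_; _:=_; :1)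
    rest-coprime : Coprime Y₀ rest
    rest-coprime = coprime-prodₚ r _ (λ i → coprime-^ {P = lin (Y (Fin.suc i))} (a (Fin.suc i)) (coprime-lin (units Fin.zero (Fin.suc i) (λ ()))))
    IH : (M *ₚ rest) ∼ (M *ₚ oneₚ)
    IH = reduce r zero z≤n (λ i → a (Fin.suc i)) (λ i → Y (Fin.suc i))
           (λ i → inj₂ (simple (Fin.suc i) , z≤n))
           (λ i j i≢j → units (Fin.suc i) (Fin.suc j) (λ eq → i≢j (suc-injective eq))) M (λ i _ → cop (Fin.suc i) z≤n)
  reduce (suc r) (suc s) (s≤s s≤r) a Y shape units M cop =
    ∼-trans (≈⇒∼ front) (∼-trans IH (≈⇒∼ (*ₚ-assoc M L² τ′)))
    where
    L² rest τ′ : Poly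
    L² = lin (Y Fin.zero) ^ₚ 2
    rest = prodₚ r (λ i → lin (Y (Fin.suc i)) ^ₚ a (Fin.suc i))
    τ′ = prodₚ s (λ j → lin (Y (Fin.suc (inject≤ j s≤r))) ^ₚ 2)
    a₀≡2 : a Fin.zero ≡ 2
    a₀≡2 with shape Fin.zero
    ... | inj₁ (a₀≡2 , _) = a₀≡2
    front : (M *ₚ ((lin (Y Fin.zero) ^ₚ a Fin.zero) *ₚ rest)) ≈ₚ ((M *ₚ L²) *ₚ rest)
    front = ≈ₚ-trans (*ₚ-congʳ M (*ₚ-congˡ rest (≈ₚ-reflexive (≡.cong (lin (Y Fin.zero) ^ₚ_) a₀≡2))))
                     (≈ₚ-sym (*ₚ-assoc M L² rest))
    shape′ : ∀ i → (a (Fin.suc i) ≡ 2 × toℕ i < s) ⊎ (a (Fin.suc i) ≡ 1 × s ≤ toℕ i)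
    shape′ i with shape (Fin.suc i)
    ... | inj₁ (a≡2 , s≤s i<s) = inj₁ (a≡2 , i<s)
    ... | inj₂ (a≡1 , s≤s s≤i) = inj₂ (a≡1 , s≤i)
    cop′ : ∀ i → s ≤ toℕ i → Coprime (Y (Fin.suc i)) (M *ₚ L²)
    cop′ i s≤i = Lin.coprime-* (Y (Fin.suc i)) (cop (Fin.suc i) (s≤s s≤i))
                   (coprime-^ {P = lin (Y Fin.zero)} 2 (coprime-lin (units (Fin.suc i) Fin.zero (λ ()))))
    IH : ((M *ₚ L²) *ₚ rest) ∼ ((M *ₚ L²) *ₚ τ′)
    IH = reduce r s s≤r (λ i → a (Fin.suc i)) (λ i → Y (Fin.suc i)) shape′
           (λ i j i≢j → units (Fin.suc i) (Fin.suc j) (λ eq → i≢j (suc-injective eq))) (M *ₚ L²) cop′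

  Σ∼τ : ∀ r s (s≤r : s ≤ r) (a : Fin r → ℕ) (Y : Fin r → Carrier)
    → (∀ i → (a i ≡ 2 × toℕ i < s) ⊎ (a i ≡ 1 × s ≤ toℕ i))
    → (∀ i j → i ≢ j → IsUnit (Y i + Y j))
    → prodₚ r (λ i → lin (Y i) ^ₚ a i) ∼ prodₚ s (λ j → lin (Y (inject≤ j s≤r)) ^ₚ 2)
  Σ∼τ r s s≤r a Y shape units =
    ∼-trans (≈⇒∼ (≈ₚ-sym (*ₚ-identityˡ _)))
      (∼-trans (reduce r s s≤r a Y shape units oneₚ (λ i _ → Lin.coprime-1 (Y i)))
               (≈⇒∼ (*ₚ-identityˡ _)))

-- In a ring whose non-units lie in 2R (such as GR(4, m)), Y + Y′ is a unit
-- as soon as μ Y ≠ μ Y′, because Y - Y′ = (Y + Y′) - 2 Y′.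
module LocalAt2 {c ℓ : Level} (R : CommutativeRing c ℓ) where
  open CommutativeRing R
  open RingDefs R
  open IntegerSolver R using (solve; _:+_; _:*_; _:-_; _:=_; :1)
  open import Relation.Binary.Reasoning.Setoid setoid

  distinct-residues⇒unit-sum : (∀ a → IsUnit a ⊎ In2R a) → ∀ {Y Y′} → ¬ (Y ≈μ Y′) → IsUnit (Y + Y′)
  distinct-residues⇒unit-sum local {Y} {Y′} Y≉Y′ with local (Y + Y′)
  ... | inj₁ unit = unit
  ... | inj₂ (b , Y+Y′≈2b) = ⊥-elim (Y≉Y′ (b - Y′ , (begin
      Y - Y′                    ≈⟨ solve 2 (λ Y Y′ → Y :- Y′ := (Y :+ Y′) :- (:1 :+ :1) :* Y′) refl Y Y′ ⟩
      (Y + Y′) - two * Y′       ≈⟨ +-congʳ Y+Y′≈2b ⟩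
      two * b - two * Y′        ≈⟨ solve 2 (λ b Y′ → (:1 :+ :1) :* b :- (:1 :+ :1) :* Y′ := (:1 :+ :1) :* (b :- Y′)) refl b Y′ ⟩
      two * (b - Y′)            ∎)))

-- The theorem: GR(4, m) is local with maximal ideal 2R, so distinct residues
-- give unit sums Y_i + Y_j.
corollary5p5 : {c ℓ : Level} (R : CommutativeRing c ℓ) (m : ℕ)
    → RingDefs.IsGaloisRing4 R m
    → (r s : ℕ) (s≤r : s ≤ r) (a : Fin r → ℕ) (Y : Fin r → CommutativeRing.Carrier R)
    → (∀ i → (a i ≡ 2 × toℕ i < s) ⊎ (a i ≡ 1 × s ≤ toℕ i))
    → (∀ i → RingDefs.μUnit R (Y i))
    → (∀ i j → ¬ (i ≡ j) → ¬ RingDefs._≈μ_ R (Y i) (Y j))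
    → let open RingDefs R
          Sig = prodₚ r (λ i → lin (Y i) ^ₚ a i)
          tau = prodₚ s (λ j → lin (Y (inject≤ j s≤r)) ^ₚ 2)
      in SameIdeal Sig (evenPart Sig) tau (evenPart tau)
corollary5p5 R m GR r s s≤r a Y shape _ distinct =
  LinearFactors.Σ∼τ R r s s≤r a Y shape
    (λ i j i≢j → LocalAt2.distinct-residues⇒unit-sum R (RingDefs.IsGaloisRing4.local2R GR) (distinct i j i≢j))
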